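{- Let $n\ge0$ and $k,\ell\geq0$ with $k+\ell\leq p^n$. Then $\Delta^k$ gives rise to an exact sequence \[0\to V_{k,n}\to V_{\ell+k,n}\xrightarrow{\Delta^k}V_{\ell,n}\to0,\] and for $x\in V_n$ one has $\Delta^k(x)\in V_{\ell,n}$ if and only if $x\in V_{\ell+k,n}$.
   Context: $p$ is a prime, $E$ a finite extension of $\mathbf{F}_p$; binomial coefficients $\binom{j}{i}$ are defined by $(1+X)^j=\sum_i\binom{j}{i}X^i$, in $\mathbf{F}_p$. $V_n$ is the space of sequences $(x_0,\dots,x_{p^n-1})$ with $x_j\in E$, with indices read in $\mathbf{Z}/p^n\mathbf{Z}$. $v_{k,n}=\left(\binom{0}{k},\dots,\binom{p^n-1}{k}\right)$ and $V_{k,n}$ is the span of $v_{0,n},\dots,v_{k-1,n}$. $\Delta:V_n\to V_n$ is $(\Delta x)_j=x_{j-1}-x_j$ (indices mod $p^n$). -}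

module Defs where

open import Level using (Level; _⊔_)
open import Algebra.Bundles using (CommutativeRing)
open import Data.Nat using (ℕ; zero; suc) renaming (_+_ to _ℕ+_)
open import Data.Fin using (Fin; zero; suc; fromℕ; inject₁; toℕ)
open import Data.Product using (Σ; ∃; _×_)
open import Relation.Nullary using (¬_)

binom : ℕ → ℕ → ℕ
binom j       zero    = 1
binom zero    (suc i) = 0
binom (suc j) (suc i) = binom j i ℕ+ binom j (suc i)

cpred : ∀ {N} → Fin N → Fin N
cpred {suc m} zero    = fromℕ m
cpred {suc m} (suc i) = inject₁ i

module _ {c ℓ : Level} (R : CommutativeRing c ℓ) where
  open CommutativeRing R using (Carrier; _≈_; _+_; _*_; 0#; 1#)

  cast : ℕ → Carrier
  cast zero    = 0#
  cast (suc m) = 1# + cast m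

  -- R is a finite field of characteristic p, i.e. a finite extension of F_p
  -- (p prime is assumed separately).
  record IsFiniteFieldOfChar (p : ℕ) : Set (c ⊔ ℓ) where
    field
      1≉0      : ¬ (1# ≈ 0#)
      inverse  : ∀ x → ¬ (x ≈ 0#) → ∃ λ y → (x * y) ≈ 1#
      char-p   : cast p ≈ 0#
      finite   : Σ ℕ λ m → Σ (Fin m → Carrier) λ f → ∀ x → ∃ λ i → f i ≈ x

module Seq {c ℓ : Level} (R : CommutativeRing c ℓ) (N : ℕ) where
  open CommutativeRing R using (Carrier; _≈_; _+_; _*_; _-_; 0#; 1#)

  -- V_n with N = p^n: sequences indexed by ℤ/Nℤ
  V : Set c
  V = Fin N → Carrier

  _≋_ : V → V → Set ℓ
  x ≋ y = ∀ j → x j ≈ y j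

  zeroV : V
  zeroV _ = 0#

  sumFin : ∀ k → (Fin k → Carrier) → Carrier
  sumFin zero    f = 0#
  sumFin (suc k) f = f zero + sumFin k (λ i → f (suc i))

  v : ℕ → V
  v k j = cast R (binom (toℕ j) k)

  InV : ℕ → V → Set (c ⊔ ℓ)
  InV k x = ∃ λ (a : Fin k → Carrier) → ∀ j → x j ≈ sumFin k (λ i → a i * v (toℕ i) j)

  Δ : V → V
  Δ x j = x (cpred j) - x j

  Δ^ : ℕ → V → V
  Δ^ zero    x = x
  Δ^ (suc k) x = Δ (Δ^ k x)

{-# OPTIONS --safe #-}
module Submission where

-- For N = p ^ n the binomial coefficients binom N i with 0 < i < N are divisible by p (since
-- i * binom N i = N * binom (N - 1) (i - 1) and p ^ n does not divide i), so in
-- characteristic p Pascal's rule v i (j - 1) + v (i + 1) (j - 1) = v (i + 1) j holds for all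
-- j in ℤ/Nℤ, including the wrap-around at j = 0.  Consequently Δ v (i + 1) = - v i (· - 1)
-- lies in V (i + 1) and, inductively, Δ v i lies in V i; so Δ maps V (m + 1) into V m.  The
-- sequence - (v i + v (i + 1)) is a Δ-preimage of v i, so this map is onto, and the kernel of
-- Δ consists of the constant sequences V 1.  Hence Δ y ∈ V m forces y ∈ V (m + 1), and
-- iterating the three one-step facts k times gives the exact sequence for Δ ^ k.

open import Defs
open import Level using (Level)
open import Algebra.Bundles using (CommutativeRing)
open import Data.Nat as ℕ using (ℕ; zero; suc; _≤_; _<_; _≤′_; ≤′-refl; ≤′-step; s≤s; z≤n)
open import Data.Nat.Properties as ℕₚ using (≤⇒≤′; ≤-trans; ≤-reflexive; <⇒≤; <⇒≱)
open import Data.Nat.Divisibility using (_∣_; divides)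
open import Data.Nat.Primality using (Prime)
open import Data.Fin using (Fin; zero; suc; toℕ; inject₁)
open import Data.Fin.Properties using (toℕ<n; toℕ-fromℕ; toℕ-inject₁)
open import Data.Product using (∃; _×_; _,_; proj₂)
open import Data.Sum using (_⊎_; inj₁; inj₂)
open import Function using (_∘_)
open import Function.Bundles using (_⇔_; mk⇔)
open import Relation.Nullary using (contradiction)
open import Relation.Binary.Bundles using (Setoid)
import Relation.Binary.PropositionalEquality as ≡
open ≡ using (_≡_)

module _ where
  open import Data.Nat using (_+_; _*_; _^_)
  open import Data.Nat.Properties using (*-comm; *-assoc; *-zeroʳ; *-identityˡ; *-distribˡ-+; +-assoc)
  open import Data.Nat.Divisibility using (m*n∣⇒m∣; *-cancelˡ-∣; *-monoˡ-∣; 1∣_; ∣⇒≤)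
  open import Data.Nat.Primality using (euclidsLemma; prime⇒nonZero)
  open ≡.≡-Reasoning

  binom-absorb : ∀ m i → suc i * binom (suc m) (suc i) ≡ suc m * binom m i
  binom-absorb zero    zero    = ≡.refl
  binom-absorb zero    (suc i) = *-zeroʳ (suc (suc i))
  binom-absorb (suc m) zero    = begin
    1 * (1 + binom (suc m) 1)  ≡⟨ *-identityˡ _ ⟩
    1 + binom (suc m) 1        ≡⟨ ≡.cong suc (≡.trans (≡.sym (*-identityˡ _)) (binom-absorb m zero)) ⟩
    suc (suc m * 1)            ∎
  binom-absorb (suc m) (suc i) = begin
    suc (suc i) * (A + B)                  ≡⟨ *-distribˡ-+ (suc (suc i)) A B ⟩
    suc (suc i) * A + suc (suc i) * B      ≡⟨ ≡.cong (suc (suc i) * A +_) (binom-absorb m (suc i)) ⟩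
    (A + suc i * A) + suc m * b            ≡⟨ ≡.cong (λ t → (A + t) + suc m * b) (binom-absorb m i) ⟩
    (A + suc m * a) + suc m * b            ≡⟨ +-assoc A _ _ ⟩
    A + (suc m * a + suc m * b)            ≡⟨ ≡.cong (A +_) (≡.sym (*-distribˡ-+ (suc m) a b)) ⟩
    A + suc m * (a + b)                    ∎
    where
    a b A B : ℕ
    a = binom m i
    b = binom m (suc i)
    A = binom (suc m) (suc i)
    B = binom (suc m) (suc (suc i))

  n∣[1+k]*binom[n,1+k] : ∀ n k → n ∣ suc k * binom n (suc k)
  n∣[1+k]*binom[n,1+k] zero    k = divides 0 (*-zeroʳ (suc k))
  n∣[1+k]*binom[n,1+k] (suc m) k =
    divides (binom m k) (≡.trans (binom-absorb m k) (*-comm (suc m) (binom m k)))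

  p^k∣m*n⇒p∣n⊎p^k∣m : ∀ {p} → Prime p → ∀ k m n → p ^ k ∣ m * n → p ∣ n ⊎ p ^ k ∣ m
  p^k∣m*n⇒p∣n⊎p^k∣m p-prime zero m n _ = inj₂ (1∣ m)
  p^k∣m*n⇒p∣n⊎p^k∣m {p} p-prime (suc k) m n p^[1+k]∣m*n
    with euclidsLemma m n p-prime (m*n∣⇒m∣ p (p ^ k) p^[1+k]∣m*n)
  ... | inj₂ p∣n = inj₁ p∣n
  ... | inj₁ (divides q ≡.refl)
    with p^k∣m*n⇒p∣n⊎p^k∣m p-prime k q n
           (*-cancelˡ-∣ p {{prime⇒nonZero p-prime}}
             (≡.subst (p * p ^ k ∣_) (≡.trans (≡.cong (_* n) (*-comm q p)) (*-assoc p q n)) p^[1+k]∣m*n))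
  ...   | inj₁ p∣n   = inj₁ p∣n
  ...   | inj₂ p^k∣q = inj₂ (≡.subst (_∣ q * p) (*-comm (p ^ k) p) (*-monoˡ-∣ p p^k∣q))

  p∣binom[p^n,1+k] : ∀ {p} → Prime p → ∀ n k → suc k < p ^ n → p ∣ binom (p ^ n) (suc k)
  p∣binom[p^n,1+k] {p} p-prime n k 1+k<p^n
    with p^k∣m*n⇒p∣n⊎p^k∣m p-prime n (suc k) (binom (p ^ n) (suc k)) (n∣[1+k]*binom[n,1+k] (p ^ n) k)
  ... | inj₁ p∣binom  = p∣binom
  ... | inj₂ p^n∣1+k = contradiction (∣⇒≤ p^n∣1+k) (<⇒≱ 1+k<p^n)

module _ {a r} (A : Setoid a r) where
  open Setoid A

  step-invariant⇒constant : ∀ {m} (f : Fin (suc m) → Carrier) →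
    (∀ j → f (suc j) ≈ f (inject₁ j)) → ∀ j → f j ≈ f zero
  step-invariant⇒constant         f step zero    = refl
  step-invariant⇒constant {suc m} f step (suc j) =
    trans (step j) (step-invariant⇒constant (f ∘ inject₁) (step ∘ inject₁) j)

module CyclicDifferences {c ℓ} (R : CommutativeRing c ℓ) where
  open CommutativeRing R hiding (zero)
  open import Relation.Binary.Reasoning.Setoid setoid
  open import Algebra.Properties.Ring ring using (x[y-z]≈xy-xz; -1*x≈-x)
  open import Algebra.Properties.AbelianGroup +-abelianGroup using (⁻¹-∙-comm)
  open import Algebra.Properties.Group +-group
    using ( x∙y⁻¹≈ε⇒x≈y; x≈y⇒x∙y⁻¹≈ε; ⁻¹-involutive; ⁻¹-anti-homo-∙
          ; \\-leftDividesˡ; \\-leftDividesʳ; //-rightDividesˡ)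
  open import Algebra.Properties.CommutativeSemigroup +-commutativeSemigroup using (interchange)
  private
    module S = Seq R

  private
    [x+y]-[z+u]≈[x-z]+[y-u] : ∀ x y z u → (x + y) - (z + u) ≈ (x - z) + (y - u)
    [x+y]-[z+u]≈[x-z]+[y-u] x y z u = trans (+-congˡ (sym (⁻¹-∙-comm z u))) (interchange x y (- z) (- u))

    [x-y]-[z-u]≈[x-z]-[y-u] : ∀ x y z u → (x - y) - (z - u) ≈ (x - z) - (y - u)
    [x-y]-[z-u]≈[x-z]-[y-u] x y z u = begin
      (x - y) + - (z - u)          ≈⟨ +-congˡ (sym (⁻¹-∙-comm z (- u))) ⟩
      (x - y) + (- z + - - u)      ≈⟨ interchange x (- y) (- z) (- - u) ⟩
      (x - z) + (- y + - - u)      ≈⟨ +-congˡ (⁻¹-∙-comm y (- u)) ⟩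
      (x - z) - (y - u)            ∎

    y-[x+y]≈-x : ∀ x y → y - (x + y) ≈ - x
    y-[x+y]≈-x x y = trans (+-congˡ (⁻¹-anti-homo-∙ x y)) (\\-leftDividesˡ y (- x))

    [-y]-[-[x+y]]≈x : ∀ x y → (- y) - (- (x + y)) ≈ x
    [-y]-[-[x+y]]≈x x y = trans (+-congˡ (trans (⁻¹-involutive _) (+-comm x y))) (\\-leftDividesʳ y x)

    x≈y+[x-y] : ∀ x y → x ≈ y + (x - y)
    x≈y+[x-y] x y = sym (trans (+-comm y (x - y)) (//-rightDividesˡ y x))

  cast-+ : ∀ m n → cast R (m ℕ.+ n) ≈ cast R m + cast R n
  cast-+ zero    n = sym (+-identityˡ _)
  cast-+ (suc m) n = trans (+-congˡ (cast-+ m n)) (sym (+-assoc 1# _ _))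

  ∣⇒cast≈0 : ∀ {p m} → cast R p ≈ 0# → p ∣ m → cast R m ≈ 0#
  ∣⇒cast≈0 {p} cast-p≈0 (divides zero    ≡.refl) = refl
  ∣⇒cast≈0 {p} cast-p≈0 (divides (suc q) ≡.refl) = begin
    cast R (p ℕ.+ q ℕ.* p)          ≈⟨ cast-+ p (q ℕ.* p) ⟩
    cast R p + cast R (q ℕ.* p)     ≈⟨ +-cong cast-p≈0 (∣⇒cast≈0 cast-p≈0 (divides q ≡.refl)) ⟩
    0# + 0#                         ≈⟨ +-identityʳ 0# ⟩
    0#                              ∎

  InnerBinomialsVanish : ℕ → Set ℓ
  InnerBinomialsVanish N = ∀ i → suc i < N → cast R (binom N (suc i)) ≈ 0#

  char-p⇒innerBinomialsVanish : ∀ {p} → Prime p → cast R p ≈ 0# → ∀ n → InnerBinomialsVanish (p ℕ.^ n)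
  char-p⇒innerBinomialsVanish p-prime cast-p≈0 n i 1+i<p^n =
    ∣⇒cast≈0 cast-p≈0 (p∣binom[p^n,1+k] p-prime n i 1+i<p^n)

  -- Pascal's rule in ℤ/Nℤ: at j = 0 the left-hand side is cast (binom N (suc i)).
  pascal-cyclic : ∀ {N} → InnerBinomialsVanish N → ∀ i → suc i < N → (j : Fin N) →
    cast R (binom (toℕ (cpred j)) i) + cast R (binom (toℕ (cpred j)) (suc i)) ≈ cast R (binom (toℕ j) (suc i))
  pascal-cyclic {suc m} vanish i 1+i<N zero rewrite toℕ-fromℕ m =
    trans (sym (cast-+ (binom m i) (binom m (suc i)))) (vanish i 1+i<N)
  pascal-cyclic {suc m} vanish i 1+i<N (suc j) rewrite toℕ-inject₁ j =
    sym (cast-+ (binom (toℕ j) i) (binom (toℕ j) (suc i)))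

  Δ-kernel⊆V₁ : ∀ {N} (u : S.V N) → (∀ j → S.Δ N u j ≈ 0#) → S.InV N 1 u
  Δ-kernel⊆V₁ {zero}  u _     = (λ _ → 0#) , λ ()
  Δ-kernel⊆V₁ {suc m} u Δu≈0 = (λ _ → u zero) , λ j → begin
    u j                          ≈⟨ step-invariant⇒constant setoid u step j ⟩
    u zero                       ≈⟨ sym (*-identityʳ _) ⟩
    u zero * 1#                  ≈⟨ sym (+-identityʳ _) ⟩
    u zero * 1# + 0#             ≈⟨ +-congʳ (*-congˡ (sym (+-identityʳ 1#))) ⟩
    u zero * (1# + 0#) + 0#      ∎
    where
    step : ∀ j → u (suc j) ≈ u (inject₁ j)
    step j = sym (x∙y⁻¹≈ε⇒x≈y _ _ (Δu≈0 (suc j)))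

  module _ {N : ℕ} where
    open Seq R N

    private variable
      k m m′ : ℕ
      x y : V

    sumFin-cong : ∀ k {f g : Fin k → Carrier} → (∀ i → f i ≈ g i) → sumFin k f ≈ sumFin k g
    sumFin-cong zero    f≈g = refl
    sumFin-cong (suc k) f≈g = +-cong (f≈g zero) (sumFin-cong k (f≈g ∘ suc))

    sumFin-+ : ∀ k (f g : Fin k → Carrier) → sumFin k (λ i → f i + g i) ≈ sumFin k f + sumFin k g
    sumFin-+ zero    f g = sym (+-identityˡ 0#)
    sumFin-+ (suc k) f g = trans (+-congˡ (sumFin-+ k (f ∘ suc) (g ∘ suc))) (interchange _ _ _ _)

    *-distribˡ-sumFin : ∀ k a (f : Fin k → Carrier) → a * sumFin k f ≈ sumFin k (λ i → a * f i)
    *-distribˡ-sumFin zero    a f = zeroʳ a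
    *-distribˡ-sumFin (suc k) a f = trans (distribˡ _ _ _) (+-congˡ (*-distribˡ-sumFin k a (f ∘ suc)))

    -- InV m x unfolds to ∃ λ a → x ≋ lincomb m a (v ∘ toℕ).
    lincomb : ∀ k → (Fin k → Carrier) → (Fin k → V) → V
    lincomb k a f j = sumFin k (λ i → a i * f i j)

    lincomb-cong : ∀ k a {f g : Fin k → V} → (∀ i → f i ≋ g i) → lincomb k a f ≋ lincomb k a g
    lincomb-cong k a f≋g j = sumFin-cong k (λ i → *-congˡ (f≋g i j))

    InV-resp-≋ : x ≋ y → InV m x → InV m y
    InV-resp-≋ x≋y (a , x≋) = a , λ j → trans (sym (x≋y j)) (x≋ j)

    InV-zero : InV m zeroV
    InV-zero {m} = (λ _ → 0#) , λ j → trans (sym (zeroˡ _)) (*-distribˡ-sumFin m 0# _)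

    InV-+ : InV m x → InV m y → InV m (λ j → x j + y j)
    InV-+ {m = m} {x = x} {y = y} (a , x≋) (b , y≋) = (λ i → a i + b i) , λ j → begin
      x j + y j                                              ≈⟨ +-cong (x≋ j) (y≋ j) ⟩
      sumFin m (λ i → a i * v (toℕ i) j) + sumFin m _        ≈⟨ sumFin-+ m _ _ ⟨
      sumFin m (λ i → a i * v (toℕ i) j + b i * v (toℕ i) j)  ≈⟨ sumFin-cong m (λ i → distribʳ _ _ _) ⟨
      sumFin m (λ i → (a i + b i) * v (toℕ i) j)              ∎

    InV-* : ∀ c → InV m x → InV m (λ j → c * x j)
    InV-* {m} c (a , x≋) = (λ i → c * a i) , λ j →
      trans (*-congˡ (x≋ j)) (trans (*-distribˡ-sumFin m c _) (sumFin-cong m (λ i → sym (*-assoc _ _ _))))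

    InV-neg : InV m x → InV m (λ j → - x j)
    InV-neg x∈ = InV-resp-≋ (λ j → -1*x≈-x _) (InV-* (- 1#) x∈)

    InV-lincomb : ∀ k a (f : Fin k → V) → (∀ i → InV m (f i)) → InV m (lincomb k a f)
    InV-lincomb zero    a f f∈ = InV-zero
    InV-lincomb (suc k) a f f∈ =
      InV-+ (InV-* (a zero) (f∈ zero)) (InV-lincomb k (a ∘ suc) (f ∘ suc) (f∈ ∘ suc))

    _∷ʳ_ : ∀ {k} → (Fin k → Carrier) → Carrier → Fin (suc k) → Carrier
    _∷ʳ_ {zero}  a c _       = c
    _∷ʳ_ {suc k} a c zero    = a zero
    _∷ʳ_ {suc k} a c (suc i) = ((a ∘ suc) ∷ʳ c) i

    sumFin-∷ʳ : ∀ k a c (g : ℕ → Carrier) →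
      sumFin (suc k) (λ i → (a ∷ʳ c) i * g (toℕ i)) ≈ sumFin k (λ i → a i * g (toℕ i)) + c * g k
    sumFin-∷ʳ zero    a c g = trans (+-identityʳ _) (sym (+-identityˡ _))
    sumFin-∷ʳ (suc k) a c g = trans (+-congˡ (sumFin-∷ʳ k (a ∘ suc) c (g ∘ suc))) (sym (+-assoc _ _ _))

    InV-extend : ∀ c → InV m x → InV (suc m) (λ j → x j + c * v m j)
    InV-extend {m} c (a , x≋) =
      (a ∷ʳ c) , λ j → trans (+-congʳ (x≋ j)) (sym (sumFin-∷ʳ m a c (λ i → v i j)))

    InV-suc : InV m x → InV (suc m) x
    InV-suc x∈ = InV-resp-≋ (λ j → trans (+-congˡ (zeroˡ _)) (+-identityʳ _)) (InV-extend 0# x∈)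

    InV-mono : m ≤ m′ → InV m x → InV m′ x
    InV-mono = mono ∘ ≤⇒≤′
      where
      mono : m ≤′ m′ → InV m x → InV m′ x
      mono ≤′-refl        = λ x∈ → x∈
      mono (≤′-step m≤m′) = InV-suc ∘ mono m≤m′

    v-InV : ∀ i → InV (suc i) (v i)
    v-InV i = InV-resp-≋ (λ j → trans (+-identityˡ _) (*-identityˡ _)) (InV-extend 1# (InV-zero {i}))

    Δ-cong : x ≋ y → Δ x ≋ Δ y
    Δ-cong x≋y j = +-cong (x≋y (cpred j)) (-‿cong (x≋y j))

    Δ^-cong : ∀ k → x ≋ y → Δ^ k x ≋ Δ^ k y
    Δ^-cong zero    x≋y = x≋y
    Δ^-cong (suc k) x≋y = Δ-cong (Δ^-cong k x≋y)

    Δ^-Δ-comm : ∀ k x → Δ^ k (Δ x) ≡ Δ (Δ^ k x)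
    Δ^-Δ-comm zero    x = ≡.refl
    Δ^-Δ-comm (suc k) x = ≡.cong Δ (Δ^-Δ-comm k x)

    Δ-lincomb : ∀ k a (f : Fin k → V) → Δ (lincomb k a f) ≋ lincomb k a (Δ ∘ f)
    Δ-lincomb zero    a f j = -‿inverseʳ 0#
    Δ-lincomb (suc k) a f j = begin
      (a zero * f zero (cpred j) + _) - (a zero * f zero j + _)  ≈⟨ [x+y]-[z+u]≈[x-z]+[y-u] _ _ _ _ ⟩
      (a zero * f zero (cpred j) - a zero * f zero j) + _        ≈⟨ +-cong (sym (x[y-z]≈xy-xz _ _ _))
                                                                            (Δ-lincomb k (a ∘ suc) (f ∘ suc) j) ⟩
      a zero * Δ (f zero) j + lincomb k (a ∘ suc) (Δ ∘ f ∘ suc) j ∎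

    Δ[x-y]≈Δx-Δy : Δ (λ j → x j - y j) ≋ λ j → Δ x j - Δ y j
    Δ[x-y]≈Δx-Δy {x = x} {y = y} j = [x-y]-[z-u]≈[x-z]-[y-u] (x (cpred j)) (y (cpred j)) (x j) (y j)

    x∘cpred≈x+Δx : ∀ x j → x (cpred j) ≈ x j + Δ x j
    x∘cpred≈x+Δx x j = x≈y+[x-y] (x (cpred j)) (x j)

    module _ (vanish : InnerBinomialsVanish N) where

      Δ-v-suc : ∀ i → suc i < N → Δ (v (suc i)) ≋ λ j → - v i (cpred j)
      Δ-v-suc i 1+i<N j = begin
        v (suc i) (cpred j) - v (suc i) j
          ≈⟨ +-congˡ (-‿cong (pascal-cyclic vanish i 1+i<N j)) ⟨
        v (suc i) (cpred j) - (v i (cpred j) + v (suc i) (cpred j))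
          ≈⟨ y-[x+y]≈-x _ _ ⟩
        - v i (cpred j)
          ∎

      Δ-v-InV : ∀ i → suc i ≤ N → InV i (Δ (v i))
      Δ-v-InV zero    _       = InV-resp-≋ (λ _ → sym (-‿inverseʳ _)) InV-zero
      Δ-v-InV (suc i) 2+i≤N =
        InV-resp-≋ (λ j → sym (trans (Δ-v-suc i 2+i≤N j) (-‿cong (x∘cpred≈x+Δx (v i) j))))
          (InV-neg (InV-+ (v-InV i) (InV-suc (Δ-v-InV i (<⇒≤ 2+i≤N)))))

      Δ-image : ∀ m → suc m ≤ N → InV (suc m) x → InV m (Δ x)
      Δ-image m 1+m≤N (a , x≋) =
        InV-resp-≋ (λ j → sym (trans (Δ-cong x≋ j) (Δ-lincomb (suc m) a (v ∘ toℕ) j)))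
          (InV-lincomb (suc m) a (Δ ∘ v ∘ toℕ) λ i →
            InV-mono (ℕₚ.≤-pred (toℕ<n i)) (Δ-v-InV (toℕ i) (≤-trans (toℕ<n i) 1+m≤N)))

      w : ℕ → V
      w i j = - (v i j + v (suc i) j)

      w-InV : ∀ i → InV (suc (suc i)) (w i)
      w-InV i = InV-neg (InV-+ (InV-suc (v-InV i)) (v-InV (suc i)))

      Δ-w : ∀ i → suc i < N → Δ (w i) ≋ v i
      Δ-w i 1+i<N j = begin
        - (v i (cpred j) + v (suc i) (cpred j)) - - (v i j + v (suc i) j)
          ≈⟨ +-congʳ (-‿cong (pascal-cyclic vanish i 1+i<N j)) ⟩
        - v (suc i) j - - (v i j + v (suc i) j)
          ≈⟨ [-y]-[-[x+y]]≈x _ _ ⟩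
        v i j
          ∎

      Δ-surjective : ∀ m → suc m ≤ N → InV m y → ∃ λ x → InV (suc m) x × Δ x ≋ y
      Δ-surjective m 1+m≤N (a , y≋) =
          lincomb m a (w ∘ toℕ)
        , InV-lincomb m a (w ∘ toℕ) (λ i → InV-mono (s≤s (toℕ<n i)) (w-InV (toℕ i)))
        , λ j → begin
            Δ (lincomb m a (w ∘ toℕ)) j       ≈⟨ Δ-lincomb m a (w ∘ toℕ) j ⟩
            lincomb m a (Δ ∘ w ∘ toℕ) j       ≈⟨ lincomb-cong m a (λ i → Δ-w (toℕ i) (2+i≤N i)) j ⟩
            lincomb m a (v ∘ toℕ) j           ≈⟨ y≋ j ⟨
            _                                 ∎
        where
        2+i≤N : ∀ (i : Fin m) → suc (suc (toℕ i)) ≤ N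
        2+i≤N i = ≤-trans (s≤s (toℕ<n i)) 1+m≤N

      Δ-preimage : ∀ m → suc m ≤ N → InV m (Δ x) → InV (suc m) x
      Δ-preimage {x = x} m 1+m≤N Δx∈ with Δ-surjective m 1+m≤N Δx∈
      ... | z , z∈ , Δz≋Δx =
        InV-resp-≋ (λ j → sym (x≈y+[x-y] (x j) (z j)))
          (InV-+ z∈ (InV-mono (s≤s z≤n) (Δ-kernel⊆V₁ (λ j → x j - z j) λ j →
            trans (Δ[x-y]≈Δx-Δy {x = x} {y = z} j) (x≈y⇒x∙y⁻¹≈ε (sym (Δz≋Δx j))))))

      Δ^-image : ∀ k {l} → k ℕ.+ l ≤ N → InV (k ℕ.+ l) x → InV l (Δ^ k x)
      Δ^-image zero    _   x∈ = x∈
      Δ^-image {x = x} (suc k) {l} k+l<N x∈ =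
        ≡.subst (InV l) (Δ^-Δ-comm k x) (Δ^-image k (<⇒≤ k+l<N) (Δ-image (k ℕ.+ l) k+l<N x∈))

      Δ^-preimage : ∀ k {l} → k ℕ.+ l ≤ N → InV l (Δ^ k x) → InV (k ℕ.+ l) x
      Δ^-preimage zero    _   Δ^x∈ = Δ^x∈
      Δ^-preimage {x = x} (suc k) {l} k+l<N Δ^x∈ =
        Δ-preimage (k ℕ.+ l) k+l<N
          (Δ^-preimage k (<⇒≤ k+l<N) (≡.subst (InV l) (≡.sym (Δ^-Δ-comm k x)) Δ^x∈))

      Δ^-surjective : ∀ k {l} → k ℕ.+ l ≤ N → InV l y → ∃ λ x → InV (k ℕ.+ l) x × Δ^ k x ≋ y
      Δ^-surjective zero    _     y∈ = _ , y∈ , λ _ → refl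
      Δ^-surjective {y = y} (suc k) k+l<N y∈ with Δ^-surjective k (<⇒≤ k+l<N) y∈
      ... | z , z∈ , Δ^z≋y with Δ-surjective _ k+l<N z∈
      ...   | x , x∈ , Δx≋z = x , x∈ , λ j → begin
        Δ (Δ^ k x) j   ≡⟨ ≡.cong-app (Δ^-Δ-comm k x) j ⟨
        Δ^ k (Δ x) j   ≈⟨ Δ^-cong k Δx≋z j ⟩
        Δ^ k z j       ≈⟨ Δ^z≋y j ⟩
        y j            ∎

      Δ^-kernel : ∀ k → k ≤ N → Δ^ k x ≋ zeroV ⇔ InV k x
      Δ^-kernel k k≤N = mk⇔
        (λ Δ^x≋0 → InV-mono (≤-reflexive (ℕₚ.+-identityʳ k)) (Δ^-preimage k k+0≤N ((λ ()) , Δ^x≋0)))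
        (λ x∈ → proj₂ (Δ^-image k k+0≤N (InV-mono (ℕₚ.m≤m+n k 0) x∈)))
        where
        k+0≤N : k ℕ.+ 0 ≤ N
        k+0≤N = ≤-trans (≤-reflexive (ℕₚ.+-identityʳ k)) k≤N

open import Data.Nat using (_+_; _^_)

lemma1p1p4 : ∀ {c ℓ' : Level} (p : ℕ) → Prime p
    → (E : CommutativeRing c ℓ') → IsFiniteFieldOfChar E p
    → (n k ℓ : ℕ) → k + ℓ ≤ p ^ n
    → let open Seq E (p ^ n) in
      -- exactness of 0 → V_k → V_{ℓ+k} → V_ℓ → 0 (via inclusion and Δ^k)
      (∀ x → InV k x → InV (ℓ + k) x)
      × (∀ x → InV (ℓ + k) x → InV ℓ (Δ^ k x))
      × (∀ x → InV (ℓ + k) x → (Δ^ k x ≋ zeroV) ⇔ InV k x)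
      × (∀ y → InV ℓ y → ∃ λ x → InV (ℓ + k) x × (Δ^ k x ≋ y))
      -- and Δ^k x ∈ V_ℓ iff x ∈ V_{ℓ+k}
      × (∀ x → InV ℓ (Δ^ k x) ⇔ InV (ℓ + k) x)
lemma1p1p4 p p-prime E E-field n k ℓ k+ℓ≤N =
    (λ _ → InV-mono (ℕₚ.m≤n+m k ℓ))
  , (λ _ → Δ^-image vanish k k+ℓ≤N ∘ InV-mono (≤-reflexive (ℕₚ.+-comm ℓ k)))
  , (λ _ _ → Δ^-kernel vanish k (≤-trans (ℕₚ.m≤m+n k ℓ) k+ℓ≤N))
  , (λ _ y∈ → let (x , x∈ , Δ^x≋y) = Δ^-surjective vanish k k+ℓ≤N y∈
              in x , InV-mono (≤-reflexive (ℕₚ.+-comm k ℓ)) x∈ , Δ^x≋y)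
  , (λ _ → mk⇔ (InV-mono (≤-reflexive (ℕₚ.+-comm k ℓ)) ∘ Δ^-preimage vanish k k+ℓ≤N)
               (Δ^-image vanish k k+ℓ≤N ∘ InV-mono (≤-reflexive (ℕₚ.+-comm ℓ k))))
  where
  open CyclicDifferences E
  vanish : InnerBinomialsVanish (p ^ n)
  vanish = char-p⇒innerBinomialsVanish p-prime (IsFiniteFieldOfChar.char-p E-field) n
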